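{- Let $a,b$ be integers with $|a|\ge 2$ and $|b|=1$, and let $(u_n)_{n\ge 0}$ be defined by $u_0=0$, $u_1=1$, $u_{n+1}=au_n+bu_{n-1}$ for $n\ge 1$. Suppose there is a finite collection of triples $(p_i,m_i,r_i)$, $1\le i\le t$, where $p_i$ are primes, $m_i$ are positive integers and $0\le r_i<m_i$ are integers, such that: (i) the primes $p_1,\dots,p_t$ are pairwise distinct; (ii) the residue classes $r_i \pmod{m_i}$, $1\le i\le t$, form a covering system, i.e. every integer lies in at least one class $r_i \pmod{m_i}$; (iii) $p_i$ divides $u_{m_i}$ for every $1\le i\le t$. Then there exist two relatively prime positive integers $x_0,x_1$ such that, for the sequence defined by $x_{n+1}=ax_n+bx_{n-1}$ ($n\ge 1$), $|x_n|$ is composite for every $n\ge 0$.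
   Context: A nonnegative integer $m$ is called composite if $m\neq 0,1$ and $m$ is not a prime number. -}

module Defs where

open import Data.Nat using (ℕ; zero; suc)
open import Data.Integer using (ℤ; _+_; _*_; 0ℤ; 1ℤ)

rec : ℤ → ℤ → ℤ → ℤ → ℕ → ℤ
rec a b x₀ x₁ zero = x₀
rec a b x₀ x₁ (suc zero) = x₁
rec a b x₀ x₁ (suc (suc n)) = a * rec a b x₀ x₁ (suc n) + b * rec a b x₀ x₁ n

lucasU : ℤ → ℤ → ℕ → ℤ
lucasU a b = rec a b 0ℤ 1ℤ

{-# OPTIONS --safe #-}

-- Let P = ∏ pᵢ, Fᵢ = P / pᵢ and sᵢ = mᵢ - rᵢ. The sequence n ↦ ∑ᵢ Fᵢ U(n + sᵢ) satisfies the
-- recurrence and is ≡ Fᵢ U(n + sᵢ) modulo pᵢ; for n ≡ rᵢ (mod mᵢ) this is ≡ 0, since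
-- pᵢ ∣ U(mᵢ) ∣ U(k mᵢ). So every sequence whose first two terms agree modulo P with its first two
-- terms α, β has each term divisible by one of the pᵢ, by the covering property. As |b| = 1,
-- consecutive terms of U are coprime, so no prime of P divides both α and β; this is what allows
-- lifting (α, β) to a coprime pair P < x₀ ≤ x₁. Finally |a| ≥ 2 and |b| = 1 make |xₙ| nondecreasing,
-- so |xₙ| > P ≥ pᵢ is a proper multiple of a prime.

module Submission where

open import Defs
open import Data.Nat using (ℕ; _≤_; _<_; NonZero)
open import Data.Nat.Primality using (Prime; Composite)
open import Data.Nat.Coprimality using (Coprime)
open import Data.Integer using (ℤ; +_; ∣_∣; _-_)
open import Data.Integer.Divisibility using () renaming (_∣_ to _∣ℤ_)
open import Data.Nat.Divisibility using (_∣_)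
open import Data.Fin using (Fin)
open import Data.Product using (∃; ∃-syntax; _×_)
open import Function.Definitions using (Injective)
open import Relation.Binary.PropositionalEquality using (_≡_)

open import Algebra.Properties.CommutativeMonoid.Sum as CommutativeMonoidSum using ()
open import Data.Empty using (⊥; ⊥-elim)
open import Data.Fin using (zero; suc; punchIn; punchOut)
open import Data.Fin.Properties using (punchInᵢ≢i; punchIn-punchOut)
open import Data.Integer as ℤ using (-[1+_]; 0ℤ; 1ℤ; _+_; _*_; -_)
open import Data.Integer.Divisibility.Signed as ℤ∣
  using (∣ᵤ⇒∣; ∣⇒∣ᵤ; ∣m∣n⇒∣m+n; ∣m∣n⇒∣m-n; ∣m⇒∣m*n; ∣n⇒∣m*n; ∣m+n∣m⇒∣n; ∣m+n∣n⇒∣m)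
  renaming (_∣_ to _∣ₛ_)
open import Data.Integer.Properties as ℤ using (abs-*; ⊖-≥; *-assoc; *-identityˡ; ∣i+j∣≤∣i∣+∣j∣; ∣-i∣≡∣i∣)
open import Data.Integer.Tactic.RingSolver using (solve-∀)
open import Data.Nat as ℕ using (zero; suc; _∸_; z≤n; s≤s)
open import Data.Nat.Divisibility as ℕ using ()
open import Data.Nat.Primality using (prime?; ¬prime[0]; ¬prime[1]; euclidsLemma; composite-≢; prime⇒nonTrivial; prime⇒nonZero)
open import Data.Nat.Properties as ℕ using ()
open import Data.List using ([]; _∷_)
open import Data.List.Relation.Unary.All using ([]; _∷_)
open import Data.Nat.Primality.Factorisation using (factorise)
open import Data.Product using (_,_; proj₁; proj₂)
open import Data.Sum using (_⊎_; inj₁; inj₂)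
open import Data.Vec.Functional using (removeAt)
open import Function using (_∘_)
open import Relation.Binary.PropositionalEquality using (_≢_; refl; sym; trans; cong; cong₂; subst; module ≡-Reasoning)
open import Relation.Nullary using (¬_; ¬?; yes; no; _×-dec_)

open CommutativeMonoidSum ℕ.*-1-commutativeMonoid using () renaming (sum to ∏; sum-remove to ∏-remove)
open CommutativeMonoidSum ℤ.+-0-commutativeMonoid using () renaming (sum to ∑; sum-remove to ∑-remove)

∣-diff-trans : ∀ {d} x y z → d ∣ₛ x - y → d ∣ₛ y - z → d ∣ₛ x - z
∣-diff-trans {d} x y z d∣x-y d∣y-z = subst (d ∣ₛ_) (telescope x y z) (∣m∣n⇒∣m+n d∣x-y d∣y-z)
  where
  telescope : ∀ x y z → (x - y) + (y - z) ≡ x - z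
  telescope = solve-∀

∣m∣m-n⇒∣n : ∀ {d} m n → d ∣ₛ m → d ∣ₛ m - n → d ∣ₛ n
∣m∣m-n⇒∣n {d} m n d∣m d∣m-n = subst (d ∣ₛ_) (sym (n≡m-[m-n] m n)) (∣m∣n⇒∣m-n d∣m d∣m-n)
  where
  n≡m-[m-n] : ∀ m n → n ≡ m - (m - n)
  n≡m-[m-n] = solve-∀

∣b∣≡1⇒b*b≡1 : ∀ b → ∣ b ∣ ≡ 1 → b * b ≡ 1ℤ
∣b∣≡1⇒b*b≡1 (+ zero)        ()
∣b∣≡1⇒b*b≡1 (+ suc zero)    refl = refl
∣b∣≡1⇒b*b≡1 (+ suc (suc _)) ()
∣b∣≡1⇒b*b≡1 -[1+ zero ]     refl = refl
∣b∣≡1⇒b*b≡1 -[1+ suc _ ]    ()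

prime-∤1 : ∀ {q} → Prime q → ¬ + q ∣ₛ 1ℤ
prime-∤1 q-prime q∣1 = ¬prime[1] (subst Prime (ℕ.∣1⇒≡1 (∣⇒∣ᵤ q∣1)) q-prime)

euclidsLemmaℤ : ∀ {q} x y → Prime q → + q ∣ₛ x * y → + q ∣ₛ x ⊎ + q ∣ₛ y
euclidsLemmaℤ {q} x y q-prime q∣xy
  with euclidsLemma ∣ x ∣ ∣ y ∣ q-prime (subst (q ∣_) (abs-* x y) (∣⇒∣ᵤ q∣xy))
... | inj₁ q∣x = inj₁ (∣ᵤ⇒∣ q∣x)
... | inj₂ q∣y = inj₂ (∣ᵤ⇒∣ q∣y)

module Recurrence (a b : ℤ) where

  U : ℕ → ℤ
  U = lucasU a b

  rec-+ : ∀ x₀ x₁ n s → rec a b x₀ x₁ (n ℕ.+ s) ≡ rec a b (rec a b x₀ x₁ s) (rec a b x₀ x₁ (suc s)) n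
  rec-+ x₀ x₁ zero          s = refl
  rec-+ x₀ x₁ (suc zero)    s = refl
  rec-+ x₀ x₁ (suc (suc n)) s = cong₂ (λ u v → a * u + b * v) (rec-+ x₀ x₁ (suc n) s) (rec-+ x₀ x₁ n s)

  rec-*ˡ : ∀ k x₀ x₁ n → rec a b (k * x₀) (k * x₁) n ≡ k * rec a b x₀ x₁ n
  rec-*ˡ k x₀ x₁ zero          = refl
  rec-*ˡ k x₀ x₁ (suc zero)    = refl
  rec-*ˡ k x₀ x₁ (suc (suc n)) rewrite rec-*ˡ k x₀ x₁ (suc n) | rec-*ˡ k x₀ x₁ n =
    pull-out a b k (rec a b x₀ x₁ (suc n)) (rec a b x₀ x₁ n)
    where
    -- The ring solver treats free variables as constants, so a and b are quantified in each identity.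
    pull-out : ∀ a b k u v → a * (k * u) + b * (k * v) ≡ k * (a * u + b * v)
    pull-out = solve-∀

  rec-decompose : ∀ x₀ x₁ n → rec a b x₀ x₁ n ≡ x₀ * rec a b 1ℤ 0ℤ n + x₁ * U n
  rec-decompose x₀ x₁ zero          = initial x₀ x₁
    where
    initial : ∀ x₀ x₁ → x₀ ≡ x₀ * 1ℤ + x₁ * 0ℤ
    initial = solve-∀
  rec-decompose x₀ x₁ (suc zero)    = initial x₀ x₁
    where
    initial : ∀ x₀ x₁ → x₁ ≡ x₀ * 0ℤ + x₁ * 1ℤ
    initial = solve-∀
  rec-decompose x₀ x₁ (suc (suc n))
    rewrite rec-decompose x₀ x₁ (suc n) | rec-decompose x₀ x₁ n =
    regroup a b x₀ x₁ (rec a b 1ℤ 0ℤ (suc n)) (U (suc n)) (rec a b 1ℤ 0ℤ n) (U n)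
    where
    regroup : ∀ a b x₀ x₁ v₁ u₁ v₀ u₀ →
      a * (x₀ * v₁ + x₁ * u₁) + b * (x₀ * v₀ + x₁ * u₀) ≡ x₀ * (a * v₁ + b * v₀) + x₁ * (a * u₁ + b * u₀)
    regroup = solve-∀

  rec-cong-∣ : ∀ {d} x₀ x₁ y₀ y₁ → d ∣ₛ x₀ - y₀ → d ∣ₛ x₁ - y₁ →
    ∀ n → d ∣ₛ rec a b x₀ x₁ n - rec a b y₀ y₁ n
  rec-cong-∣ x₀ x₁ y₀ y₁ h₀ h₁ zero          = h₀
  rec-cong-∣ x₀ x₁ y₀ y₁ h₀ h₁ (suc zero)    = h₁
  rec-cong-∣ {d} x₀ x₁ y₀ y₁ h₀ h₁ (suc (suc n)) =
    subst (d ∣ₛ_) (sym (regroup a b (rec a b x₀ x₁ (suc n)) (rec a b y₀ y₁ (suc n)) (rec a b x₀ x₁ n) (rec a b y₀ y₁ n)))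
      (∣m∣n⇒∣m+n (∣n⇒∣m*n a (rec-cong-∣ x₀ x₁ y₀ y₁ h₀ h₁ (suc n))) (∣n⇒∣m*n b (rec-cong-∣ x₀ x₁ y₀ y₁ h₀ h₁ n)))
    where
    regroup : ∀ a b u₁ w₁ u₀ w₀ → (a * u₁ + b * u₀) - (a * w₁ + b * w₀) ≡ a * (u₁ - w₁) + b * (u₀ - w₀)
    regroup = solve-∀

  ∣lucasU⇒∣rec-+ : ∀ {d} m x₀ x₁ n → d ∣ₛ U m → d ∣ₛ rec a b x₀ x₁ n → d ∣ₛ rec a b x₀ x₁ (m ℕ.+ n)
  ∣lucasU⇒∣rec-+ {d} m x₀ x₁ n d∣Uₘ d∣wₙ =
    subst (d ∣ₛ_) (sym (trans (rec-+ x₀ x₁ m n) (rec-decompose _ _ m)))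
      (∣m∣n⇒∣m+n (∣m⇒∣m*n (rec a b 1ℤ 0ℤ m) d∣wₙ) (∣n⇒∣m*n (rec a b x₀ x₁ (suc n)) d∣Uₘ))

  ∣lucasU⇒∣lucasU-* : ∀ {d} m k → d ∣ₛ U m → d ∣ₛ U (k ℕ.* m)
  ∣lucasU⇒∣lucasU-* m zero    d∣Uₘ = ℤ∣.divides 0ℤ refl
  ∣lucasU⇒∣lucasU-* m (suc k) d∣Uₘ = ∣lucasU⇒∣rec-+ m 0ℤ 1ℤ (k ℕ.* m) d∣Uₘ (∣lucasU⇒∣lucasU-* m k d∣Uₘ)

  ∣lucasU-consecutive⇒∣1 : ∣ b ∣ ≡ 1 → ∀ {d} k → d ∣ₛ U k → d ∣ₛ U (suc k) → d ∣ₛ 1ℤ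
  ∣lucasU-consecutive⇒∣1 ∣b∣≡1 zero    _      d∣U₁   = d∣U₁
  ∣lucasU-consecutive⇒∣1 ∣b∣≡1 {d} (suc k) d∣Uₖ₊₁ d∣Uₖ₊₂ =
    ∣lucasU-consecutive⇒∣1 ∣b∣≡1 k (subst (d ∣ₛ_) b*[b*Uₖ]≡Uₖ (∣n⇒∣m*n b d∣b*Uₖ)) d∣Uₖ₊₁
    where
    d∣b*Uₖ : d ∣ₛ b * U k
    d∣b*Uₖ = ∣m+n∣m⇒∣n d∣Uₖ₊₂ (∣n⇒∣m*n a d∣Uₖ₊₁)
    b*[b*Uₖ]≡Uₖ : b * (b * U k) ≡ U k
    b*[b*Uₖ]≡Uₖ = begin
      b * (b * U k) ≡⟨ sym (*-assoc b b (U k)) ⟩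
      (b * b) * U k ≡⟨ cong (_* U k) (∣b∣≡1⇒b*b≡1 b ∣b∣≡1) ⟩
      1ℤ * U k      ≡⟨ *-identityˡ (U k) ⟩
      U k           ∎
      where open ≡-Reasoning

  prime∣scaled-consecutive⇒∣ : ∣ b ∣ ≡ 1 → ∀ {q} → Prime q → ∀ x k →
    + q ∣ₛ x * U k → + q ∣ₛ x * U (suc k) → + q ∣ₛ x
  prime∣scaled-consecutive⇒∣ ∣b∣≡1 q-prime x k q∣xUₖ q∣xUₖ₊₁
    with euclidsLemmaℤ x (U k) q-prime q∣xUₖ | euclidsLemmaℤ x (U (suc k)) q-prime q∣xUₖ₊₁
  ... | inj₁ q∣x | _        = q∣x
  ... | inj₂ _   | inj₁ q∣x = q∣x
  ... | inj₂ q∣Uₖ | inj₂ q∣Uₖ₊₁ = ⊥-elim (prime-∤1 q-prime (∣lucasU-consecutive⇒∣1 ∣b∣≡1 k q∣Uₖ q∣Uₖ₊₁))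

  module _ (2≤∣a∣ : 2 ≤ ∣ a ∣) (∣b∣≡1 : ∣ b ∣ ≡ 1) where

    ∣y₁∣≤∣ay₁+by₀∣ : ∀ y₀ y₁ → ∣ y₀ ∣ ≤ ∣ y₁ ∣ → ∣ y₁ ∣ ≤ ∣ a * y₁ + b * y₀ ∣
    ∣y₁∣≤∣ay₁+by₀∣ y₀ y₁ ∣y₀∣≤∣y₁∣ = ℕ.+-cancelʳ-≤ (∣ y₀ ∣) _ _ (begin
      ∣ y₁ ∣ ℕ.+ ∣ y₀ ∣      ≤⟨ ℕ.+-monoʳ-≤ ∣ y₁ ∣ ∣y₀∣≤∣y₁∣ ⟩
      ∣ y₁ ∣ ℕ.+ ∣ y₁ ∣      ≡⟨ cong (∣ y₁ ∣ ℕ.+_) (sym (ℕ.+-identityʳ ∣ y₁ ∣)) ⟩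
      2 ℕ.* ∣ y₁ ∣           ≤⟨ ℕ.*-monoˡ-≤ ∣ y₁ ∣ 2≤∣a∣ ⟩
      ∣ a ∣ ℕ.* ∣ y₁ ∣       ≡⟨ sym (abs-* a y₁) ⟩
      ∣ a * y₁ ∣             ≡⟨ cong ∣_∣ (split a y₁ (b * y₀)) ⟩
      ∣ z + - (b * y₀) ∣     ≤⟨ ∣i+j∣≤∣i∣+∣j∣ z (- (b * y₀)) ⟩
      ∣ z ∣ ℕ.+ ∣ - (b * y₀) ∣ ≡⟨ cong (∣ z ∣ ℕ.+_) ∣-by₀∣≡∣y₀∣ ⟩
      ∣ z ∣ ℕ.+ ∣ y₀ ∣       ∎)
      where
      open ℕ.≤-Reasoning
      z : ℤ
      z = a * y₁ + b * y₀
      split : ∀ a y₁ c → a * y₁ ≡ (a * y₁ + c) + - c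
      split = solve-∀
      ∣-by₀∣≡∣y₀∣ : ∣ - (b * y₀) ∣ ≡ ∣ y₀ ∣
      ∣-by₀∣≡∣y₀∣ = trans (∣-i∣≡∣i∣ (b * y₀))
        (trans (abs-* b y₀) (trans (cong (ℕ._* ∣ y₀ ∣) ∣b∣≡1) (ℕ.*-identityˡ ∣ y₀ ∣)))

    ∣rec∣-growing : ∀ x₀ x₁ → ∣ x₀ ∣ ≤ ∣ x₁ ∣ → ∀ n →
      ∣ x₀ ∣ ≤ ∣ rec a b x₀ x₁ n ∣ × ∣ rec a b x₀ x₁ n ∣ ≤ ∣ rec a b x₀ x₁ (suc n) ∣
    ∣rec∣-growing x₀ x₁ ∣x₀∣≤∣x₁∣ zero    = ℕ.≤-refl , ∣x₀∣≤∣x₁∣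
    ∣rec∣-growing x₀ x₁ ∣x₀∣≤∣x₁∣ (suc n) =
      let ∣x₀∣≤∣wₙ∣ , ∣wₙ∣≤∣wₙ₊₁∣ = ∣rec∣-growing x₀ x₁ ∣x₀∣≤∣x₁∣ n
      in  ℕ.≤-trans ∣x₀∣≤∣wₙ∣ ∣wₙ∣≤∣wₙ₊₁∣ , ∣y₁∣≤∣ay₁+by₀∣ _ _ ∣wₙ∣≤∣wₙ₊₁∣

    composite-rec : ∀ {x₀ x₁ q} n → x₀ ≤ x₁ → Prime q → q < x₀ →
      + q ∣ₛ rec a b (+ x₀) (+ x₁) n → Composite ∣ rec a b (+ x₀) (+ x₁) n ∣
    composite-rec {x₀} {x₁} {q} n x₀≤x₁ q-prime q<x₀ q∣wₙ =
      composite-≢ q {{prime⇒nonTrivial q-prime}} {{ℕ.>-nonZero (ℕ.≤-trans (s≤s z≤n) q<∣wₙ∣)}}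
        (ℕ.<⇒≢ q<∣wₙ∣) (∣⇒∣ᵤ q∣wₙ)
      where
      q<∣wₙ∣ : q < ∣ rec a b (+ x₀) (+ x₁) n ∣
      q<∣wₙ∣ = ℕ.<-≤-trans q<x₀ (proj₁ (∣rec∣-growing (+ x₀) (+ x₁) x₀≤x₁ n))

  ∣rec-of-residues : ∀ {d} m s f x₀ x₁ → d ∣ₛ U m → d ∣ₛ x₀ - f * U s → d ∣ₛ x₁ - f * U (suc s) →
    ∀ n → m ∣ n ℕ.+ s → d ∣ₛ rec a b x₀ x₁ n
  ∣rec-of-residues {d} m s f x₀ x₁ d∣Uₘ h₀ h₁ n (ℕ.divides k n+s≡km) =
    subst (d ∣ₛ_) (sym (x≡[x-y]+y _ _))
      (∣m∣n⇒∣m+n (rec-cong-∣ x₀ x₁ _ _ h₀ h₁ n) (subst (d ∣ₛ_) (sym shifted) (∣n⇒∣m*n f d∣Uₙ₊ₛ)))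
    where
    x≡[x-y]+y : ∀ x y → x ≡ (x - y) + y
    x≡[x-y]+y = solve-∀
    shifted : rec a b (f * U s) (f * U (suc s)) n ≡ f * U (n ℕ.+ s)
    shifted = trans (rec-*ˡ f (U s) (U (suc s)) n) (cong (f *_) (sym (rec-+ 0ℤ 1ℤ n s)))
    d∣Uₙ₊ₛ : d ∣ₛ U (n ℕ.+ s)
    d∣Uₙ₊ₛ = subst (λ j → d ∣ₛ U j) (sym n+s≡km) (∣lucasU⇒∣lucasU-* m k d∣Uₘ)

prime∣prime⇒≡ : ∀ {q p} → Prime q → Prime p → q ∣ p → q ≡ p
prime∣prime⇒≡ {q} {p} q-prime p-prime q∣p with q ℕ.≟ p
... | yes q≡p = q≡p
... | no  q≢p = ⊥-elim (Prime.notComposite p-prime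
  (composite-≢ q {{prime⇒nonTrivial q-prime}} {{prime⇒nonZero p-prime}} q≢p q∣p))

∣∏ : ∀ {t} (f : Fin t → ℕ) i → f i ∣ ∏ f
∣∏ {suc t} f i = subst (f i ∣_) (sym (∏-remove f)) (ℕ.m∣m*n _)

∏-nonZero : ∀ {t} (f : Fin t → ℕ) → (∀ i → NonZero (f i)) → NonZero (∏ f)
∏-nonZero {zero}  f f≢0 = _
∏-nonZero {suc t} f f≢0 = ℕ.m*n≢0 _ _ {{f≢0 zero}} {{∏-nonZero (f ∘ suc) (f≢0 ∘ suc)}}

prime∣∏⇒∣ : ∀ {t} (f : Fin t → ℕ) {q} → Prime q → q ∣ ∏ f → ∃[ i ] q ∣ f i
prime∣∏⇒∣ {zero}  f q-prime q∣1 = ⊥-elim (¬prime[1] (subst Prime (ℕ.∣1⇒≡1 q∣1) q-prime))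
prime∣∏⇒∣ {suc t} f q-prime q∣∏ with euclidsLemma (f zero) (∏ (f ∘ suc)) q-prime q∣∏
... | inj₁ q∣f₀ = zero , q∣f₀
... | inj₂ q∣∏′ = let i , q∣fᵢ = prime∣∏⇒∣ (f ∘ suc) q-prime q∣∏′ in suc i , q∣fᵢ

cofactor : ∀ {t} → (Fin t → ℕ) → Fin t → ℕ
cofactor {suc t} f i = ∏ (removeAt f i)

∣cofactor : ∀ {t} (f : Fin t → ℕ) {i j} → i ≢ j → f j ∣ cofactor f i
∣cofactor {suc t} f {i} i≢j =
  subst (_∣ cofactor f i) (cong f (punchIn-punchOut i≢j)) (∣∏ (removeAt f i) (punchOut i≢j))

prime∤cofactor : ∀ {t} (p : Fin t → ℕ) → (∀ i → Prime (p i)) → Injective _≡_ _≡_ p →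
  ∀ i → ¬ p i ∣ cofactor p i
prime∤cofactor {suc t} p p-prime p-injective i pᵢ∣cofactor =
  let k , pᵢ∣pₖ = prime∣∏⇒∣ (removeAt p i) (p-prime i) pᵢ∣cofactor
  in  punchInᵢ≢i i k (sym (p-injective (prime∣prime⇒≡ (p-prime i) (p-prime _) pᵢ∣pₖ)))

∣∑ : ∀ {t d} (f : Fin t → ℤ) → (∀ i → d ∣ₛ f i) → d ∣ₛ ∑ f
∣∑ {zero}  f d∣f = ℤ∣.divides 0ℤ refl
∣∑ {suc t} f d∣f = ∣m∣n⇒∣m+n (d∣f zero) (∣∑ (f ∘ suc) (d∣f ∘ suc))

∣∑-term : ∀ {t d} (f : Fin t → ℤ) i → (∀ j → j ≢ i → d ∣ₛ f j) → d ∣ₛ ∑ f - f i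
∣∑-term {suc t} {d} f i d∣fⱼ =
  subst (d ∣ₛ_) (sym ∑f-fᵢ≡∑rest) (∣∑ (removeAt f i) (λ k → d∣fⱼ (punchIn i k) (punchInᵢ≢i i k)))
  where
  cancel : ∀ x y → (x + y) - x ≡ y
  cancel = solve-∀
  ∑f-fᵢ≡∑rest : ∑ f - f i ≡ ∑ (removeAt f i)
  ∑f-fᵢ≡∑rest = trans (cong (_- f i) (∑-remove f)) (cancel (f i) _)

primorialCoprimeTo : ℕ → ℕ → ℕ
primorialCoprimeTo A zero = 1
primorialCoprimeTo A (suc n) with prime? (suc n) ×-dec ¬? (suc n ℕ.∣? A)
... | yes _ = suc n ℕ.* primorialCoprimeTo A n
... | no  _ = primorialCoprimeTo A n

prime∣primorialCoprimeTo : ∀ {q} A n → Prime q → q ≤ n → ¬ q ∣ A → q ∣ primorialCoprimeTo A n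
prime∣primorialCoprimeTo A zero q-prime q≤0 _ =
  ⊥-elim (¬prime[0] (subst Prime (ℕ.n≤0⇒n≡0 q≤0) q-prime))
prime∣primorialCoprimeTo A (suc n) q-prime q≤1+n q∤A
  with prime? (suc n) ×-dec ¬? (suc n ℕ.∣? A) | ℕ.m≤n⇒m<n∨m≡n q≤1+n
... | yes _      | inj₂ refl  = ℕ.m∣m*n _
... | no  ¬q∤A   | inj₂ refl  = ⊥-elim (¬q∤A (q-prime , q∤A))
... | yes _      | inj₁ q<1+n = ℕ.∣n⇒∣m*n (suc n) (prime∣primorialCoprimeTo A n q-prime (ℕ.s≤s⁻¹ q<1+n) q∤A)
... | no  _      | inj₁ q<1+n = prime∣primorialCoprimeTo A n q-prime (ℕ.s≤s⁻¹ q<1+n) q∤A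

prime∣primorialCoprimeTo⇒∤ : ∀ {q} A n → Prime q → q ∣ primorialCoprimeTo A n → ¬ q ∣ A
prime∣primorialCoprimeTo⇒∤ A zero    q-prime q∣1 _ = ¬prime[1] (subst Prime (ℕ.∣1⇒≡1 q∣1) q-prime)
prime∣primorialCoprimeTo⇒∤ A (suc n) q-prime q∣∏ with prime? (suc n) ×-dec ¬? (suc n ℕ.∣? A)
... | no _ = prime∣primorialCoprimeTo⇒∤ A n q-prime q∣∏
... | yes (1+n-prime , 1+n∤A) with euclidsLemma (suc n) _ q-prime q∣∏
...   | inj₁ q∣1+n = subst (λ d → ¬ d ∣ A) (sym (prime∣prime⇒≡ q-prime 1+n-prime q∣1+n)) 1+n∤A
...   | inj₂ q∣∏′  = prime∣primorialCoprimeTo⇒∤ A n q-prime q∣∏′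

noCommonPrime⇒coprime : ∀ {m n} .{{_ : NonZero m}} → (∀ {q} → Prime q → q ∣ m → q ∣ n → ⊥) → Coprime m n
noCommonPrime⇒coprime {m} noCommon {zero}    (0∣m , _) = ⊥-elim (ℕ.≢-nonZero⁻¹ m (ℕ.0∣⇒≡0 0∣m))
noCommonPrime⇒coprime     noCommon {suc d} (d∣m , d∣n) with factorise (suc d)
... | record { factors = [] ; isFactorisation = d≡1 } = d≡1
... | record { factors = q ∷ _ ; isFactorisation = d≡q*qs ; factorsPrime = q-prime ∷ _ } =
  ⊥-elim (noCommon q-prime (ℕ.∣-trans q∣d d∣m) (ℕ.∣-trans q∣d d∣n))
  where
  q∣d : q ∣ suc d
  q∣d = subst (q ∣_) (sym d≡q*qs) (ℕ.m∣m*n _)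

lift-to-ℕ : ∀ z K N → ∣ z ∣ ℕ.+ N ≤ K → ∃[ x ] z + + K ≡ + x × N ≤ x
lift-to-ℕ (+ k)     K N ∣z∣+N≤K = k ℕ.+ K , refl , ℕ.≤-trans (ℕ.m+n≤o⇒n≤o k ∣z∣+N≤K) (ℕ.m≤n+m K k)
lift-to-ℕ -[1+ k ]  K N ∣z∣+N≤K = K ∸ suc k , ⊖-≥ (ℕ.m+n≤o⇒m≤o (suc k) ∣z∣+N≤K) ,
  subst (_≤ K ∸ suc k) (ℕ.m+n∸m≡n (suc k) N) (ℕ.∸-monoˡ-≤ (suc k) ∣z∣+N≤K)

∃-representative : ∀ M .{{_ : NonZero M}} z N → ∃[ x ] N ≤ x × + M ∣ₛ + x - z
∃-representative M z N =
  let x , z+K≡x , N≤x = lift-to-ℕ z (M ℕ.* K) N (ℕ.m≤n*m K M)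
  in  x , N≤x , subst (+ M ∣ₛ_) (x-z≡K z+K≡x) (∣ᵤ⇒∣ (ℕ.m∣m*n K))
  where
  K : ℕ
  K = ∣ z ∣ ℕ.+ N
  cancel : ∀ z k → k ≡ (z + k) - z
  cancel = solve-∀
  x-z≡K : ∀ {x} → z + + (M ℕ.* K) ≡ + x → + (M ℕ.* K) ≡ + x - z
  x-z≡K z+K≡x = trans (cancel z _) (cong (_- z) z+K≡x)

module CoprimeLift (P : ℕ) .{{_ : NonZero P}} (α β : ℤ)
  (noCommonPrime : ∀ {q} → Prime q → q ∣ P → + q ∣ₛ α → + q ∣ₛ β → ⊥) where

  private
    cancelˡ : ∀ x y → (x + y) - x ≡ y
    cancelˡ = solve-∀
    cancelʳ : ∀ x y → (x + y) - y ≡ x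
    cancelʳ = solve-∀

  B : ℕ
  B = proj₁ (∃-representative P β 1)

  1≤B : 1 ≤ B
  1≤B = proj₁ (proj₂ (∃-representative P β 1))

  P∣B-β : + P ∣ₛ + B - β
  P∣B-β = proj₂ (proj₂ (∃-representative P β 1))

  instance
    B≢0 : NonZero B
    B≢0 = ℕ.>-nonZero 1≤B

  c : ℕ
  c = primorialCoprimeTo ∣ α ∣ B

  γ : ℤ
  γ = α + + (P ℕ.* c)

  P∣γ-α : + P ∣ₛ γ - α
  P∣γ-α = subst (+ P ∣ₛ_) (sym (cancelˡ α _)) (∣ᵤ⇒∣ (ℕ.m∣m*n c))

  -- c is divisible by every prime of B not dividing α and by no prime of α, so α + P c avoids every prime of B.
  prime∣B⇒∤γ : ∀ {q} → Prime q → q ∣ B → ¬ + q ∣ₛ γ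
  prime∣B⇒∤γ {q} q-prime q∣B q∣γ with + q ℤ∣.∣? α
  ... | yes q∣α with euclidsLemma P c q-prime (∣⇒∣ᵤ (∣m+n∣m⇒∣n q∣γ q∣α))
  ...   | inj₁ q∣P = noCommonPrime q-prime q∣P q∣α
                       (∣m∣m-n⇒∣n (+ B) β (∣ᵤ⇒∣ q∣B) (ℤ∣.∣-trans (∣ᵤ⇒∣ {+ q} {+ P} q∣P) P∣B-β))
  ...   | inj₂ q∣c = prime∣primorialCoprimeTo⇒∤ ∣ α ∣ B q-prime q∣c (∣⇒∣ᵤ q∣α)
  prime∣B⇒∤γ {q} q-prime q∣B q∣γ | no q∤α =
    let q∣c = prime∣primorialCoprimeTo ∣ α ∣ B q-prime (ℕ.∣⇒≤ q∣B) (q∤α ∘ ∣ᵤ⇒∣)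
    in  q∤α (∣m+n∣n⇒∣m q∣γ (∣ᵤ⇒∣ (ℕ.∣n⇒∣m*n P q∣c)))

  instance
    PB≢0 : NonZero (P ℕ.* B)
    PB≢0 = ℕ.m*n≢0 P B

  x₀ : ℕ
  x₀ = proj₁ (∃-representative (P ℕ.* B) γ (suc P))

  P<x₀ : P < x₀
  P<x₀ = proj₁ (proj₂ (∃-representative (P ℕ.* B) γ (suc P)))

  PB∣x₀-γ : + (P ℕ.* B) ∣ₛ + x₀ - γ
  PB∣x₀-γ = proj₂ (proj₂ (∃-representative (P ℕ.* B) γ (suc P)))

  instance
    x₀≢0 : NonZero x₀
    x₀≢0 = ℕ.>-nonZero (ℕ.≤-trans (s≤s z≤n) P<x₀)

  x₁ : ℕ
  x₁ = P ℕ.* (x₀ ℕ.* x₀) ℕ.+ B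

  x₀≤x₁ : x₀ ≤ x₁
  x₀≤x₁ = ℕ.≤-trans (ℕ.m≤m*n x₀ x₀) (ℕ.≤-trans (ℕ.m≤n*m (x₀ ℕ.* x₀) P) (ℕ.m≤m+n _ B))

  P∣x₀-α : + P ∣ₛ + x₀ - α
  P∣x₀-α = ∣-diff-trans (+ x₀) γ α (ℤ∣.∣-trans (∣ᵤ⇒∣ {+ P} {+ (P ℕ.* B)} (ℕ.m∣m*n B)) PB∣x₀-γ) P∣γ-α

  P∣x₁-β : + P ∣ₛ + x₁ - β
  P∣x₁-β = ∣-diff-trans (+ x₁) (+ B) β (subst (+ P ∣ₛ_) x₁-B (∣ᵤ⇒∣ (ℕ.m∣m*n (x₀ ℕ.* x₀)))) P∣B-β
    where
    x₁-B : + (P ℕ.* (x₀ ℕ.* x₀)) ≡ + x₁ - + B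
    x₁-B = sym (trans (cong (_- + B) (ℤ.pos-+ (P ℕ.* (x₀ ℕ.* x₀)) B)) (cancelʳ _ (+ B)))

  coprime-x₀-x₁ : Coprime x₀ x₁
  coprime-x₀-x₁ = noCommonPrime⇒coprime λ {q} q-prime q∣x₀ q∣x₁ →
    let q∣B = ℕ.∣m+n∣m⇒∣n q∣x₁ (ℕ.∣n⇒∣m*n P (ℕ.∣m⇒∣m*n x₀ q∣x₀))
        q∣x₀-γ = ℤ∣.∣-trans (∣ᵤ⇒∣ {+ q} {+ (P ℕ.* B)} (ℕ.∣n⇒∣m*n P q∣B)) PB∣x₀-γ
    in  prime∣B⇒∤γ q-prime q∣B
          (∣m∣m-n⇒∣n (+ x₀) γ (∣ᵤ⇒∣ q∣x₀) q∣x₀-γ)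

covering⇒∣ : ∀ {m r} n → r < m → + m ∣ℤ + n - + r → m ∣ n ℕ.+ (m ∸ r)
covering⇒∣ {m} {r} n r<m m∣n-r =
  ∣⇒∣ᵤ (subst (+ m ∣ₛ_) n-r+m≡n+[m∸r] (∣m∣n⇒∣m+n (∣ᵤ⇒∣ {+ m} {+ n - + r} m∣n-r) ℤ∣.∣-refl))
  where
  open ≡-Reasoning
  swap : ∀ x y z → (x - y) + z ≡ x + (z - y)
  swap = solve-∀
  n-r+m≡n+[m∸r] : (+ n - + r) + + m ≡ + (n ℕ.+ (m ∸ r))
  n-r+m≡n+[m∸r] = begin
    (+ n - + r) + + m   ≡⟨ swap (+ n) (+ r) (+ m) ⟩
    + n + (+ m - + r)   ≡⟨ cong (λ z → + n + z) (trans (ℤ.m-n≡m⊖n m r) (⊖-≥ (ℕ.<⇒≤ r<m))) ⟩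
    + n + + (m ∸ r)     ≡⟨ sym (ℤ.pos-+ n (m ∸ r)) ⟩
    + (n ℕ.+ (m ∸ r))   ∎

module CoveringResidues (a b : ℤ) (∣b∣≡1 : ∣ b ∣ ≡ 1) {t} (p : Fin t → ℕ)
  (p-prime : ∀ i → Prime (p i)) (p-injective : Injective _≡_ _≡_ p) (s : Fin t → ℕ) where

  open Recurrence a b

  weight : Fin t → ℤ
  weight i = + cofactor p i

  α β : ℤ
  α = ∑ λ i → weight i * U (s i)
  β = ∑ λ i → weight i * U (suc (s i))

  pᵢ∣weighted-residue : ∀ (k : Fin t → ℕ) i → + p i ∣ₛ ∑ (λ j → weight j * U (k j)) - weight i * U (k i)
  pᵢ∣weighted-residue k i =
    ∣∑-term (λ j → weight j * U (k j)) i λ j j≢i → ∣m⇒∣m*n (U (k j)) (∣ᵤ⇒∣ {+ p i} {weight j} (∣cofactor p j≢i))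

  pᵢ∣α-residue : ∀ i → + p i ∣ₛ α - weight i * U (s i)
  pᵢ∣α-residue = pᵢ∣weighted-residue s

  pᵢ∣β-residue : ∀ i → + p i ∣ₛ β - weight i * U (suc (s i))
  pᵢ∣β-residue = pᵢ∣weighted-residue (λ i → suc (s i))

  noCommonPrime : ∀ {q} → Prime q → q ∣ ∏ p → + q ∣ₛ α → + q ∣ₛ β → ⊥
  noCommonPrime q-prime q∣P q∣α q∣β with prime∣∏⇒∣ p q-prime q∣P
  ... | j , q∣pⱼ rewrite prime∣prime⇒≡ q-prime (p-prime j) q∣pⱼ =
    prime∤cofactor p p-prime p-injective j (∣⇒∣ᵤ
      (prime∣scaled-consecutive⇒∣ ∣b∣≡1 (p-prime j) (weight j) (s j)
            (∣m∣m-n⇒∣n α _ q∣α (pᵢ∣α-residue j)) (∣m∣m-n⇒∣n β _ q∣β (pᵢ∣β-residue j))))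

lemma5p4 : (a b : ℤ) → 2 ≤ ∣ a ∣ → ∣ b ∣ ≡ 1 →
    (t : ℕ) (p m r : Fin t → ℕ) →
    (∀ i → Prime (p i)) → (∀ i → 1 ≤ m i) → (∀ i → r i < m i) →
    Injective _≡_ _≡_ p →
    (∀ (n : ℤ) → ∃[ i ] (+ (m i) ∣ℤ (n - + (r i)))) →
    (∀ i → p i ∣ ∣ lucasU a b (m i) ∣) →
    ∃[ x₀ ] ∃[ x₁ ] (1 ≤ x₀ × 1 ≤ x₁ × Coprime x₀ x₁ ×
      (∀ n → Composite ∣ rec a b (+ x₀) (+ x₁) n ∣))
lemma5p4 a b 2≤∣a∣ ∣b∣≡1 t p m r p-prime _ r<m p-injective covering pᵢ∣Uₘᵢ =
  x₀ , x₁ , 1≤x₀ , ℕ.≤-trans 1≤x₀ x₀≤x₁ , coprime-x₀-x₁ , composite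
  where
  open Recurrence a b
  open CoveringResidues a b ∣b∣≡1 p p-prime p-injective (λ i → m i ∸ r i)
  instance
    P≢0 : NonZero (∏ p)
    P≢0 = ∏-nonZero p (prime⇒nonZero ∘ p-prime)
  open CoprimeLift (∏ p) α β noCommonPrime

  1≤x₀ : 1 ≤ x₀
  1≤x₀ = ℕ.≤-trans (s≤s z≤n) P<x₀

  composite : ∀ n → Composite ∣ rec a b (+ x₀) (+ x₁) n ∣
  composite n =
    let i , mᵢ∣n-rᵢ = covering (+ n)
        pᵢ∣P = ∣ᵤ⇒∣ {+ p i} {+ ∏ p} (∣∏ p i)
    in  composite-rec 2≤∣a∣ ∣b∣≡1 n x₀≤x₁ (p-prime i) (ℕ.≤-<-trans (ℕ.∣⇒≤ (∣∏ p i)) P<x₀)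
          (∣rec-of-residues (m i) (m i ∸ r i) (weight i) (+ x₀) (+ x₁) (∣ᵤ⇒∣ (pᵢ∣Uₘᵢ i))
            (∣-diff-trans (+ x₀) α _ (ℤ∣.∣-trans pᵢ∣P P∣x₀-α) (pᵢ∣α-residue i))
            (∣-diff-trans (+ x₁) β _ (ℤ∣.∣-trans pᵢ∣P P∣x₁-β) (pᵢ∣β-residue i))
            n (covering⇒∣ n (r<m i) mᵢ∣n-rᵢ))
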